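{- Let $k, \ell$ be non-negative integers with $\ell < 2k$, and let $H = (V, F)$ be a $(k, \ell)$-sparse loopless multigraph with $n = |V|$. Then the sum of the sizes $|C|$ over all $(k, \ell)$-components $C$ of $H$ is $O(n)$ (with the implied constant depending only on $k$ and $\ell$).
   Context: For $X \subseteq V$, $i_H(X)$ denotes the number of edges with both endpoints in $X$. A graph is $(k, \ell)$-sparse if $i_H(X) \le \max\{k|X| - \ell, 0\}$ for every vertex subset $X$, and $(k, \ell)$-tight if it is $(k, \ell)$-sparse and has exactly $\max\{k|V| - \ell, 0\}$ edges. A $(k, \ell)$-block of a $(k, \ell)$-sparse graph is a vertex subset whose induced subgraph is $(k, \ell)$-tight; a $(k, \ell)$-component is an inclusion-wise maximal $(k, \ell)$-block. -}

module Defs where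

open import Data.Nat using (ℕ; zero; suc; _+_; _*_; _∸_; _≤_; _<_)
open import Data.Nat.Properties using (_≤?_; _≟_)
open import Data.Fin using (Fin)
open import Data.Fin.Subset using (Subset; _∈_; _⊆_; ∣_∣; inside; outside)
open import Data.Fin.Subset.Properties using (_∈?_; _⊆?_; anySubset?)
open import Data.Product using (_×_; proj₁; proj₂; _,_; ∃)
open import Data.List using (List; []; _∷_; filter; length; map; _++_)
open import Data.Nat.ListAction using (sum)
import Agda.Primitive
open import Data.List.Relation.Unary.All using (All)
open import Data.Vec using (_∷_; [])
open import Data.Bool using (if_then_else_)
open import Relation.Nullary using (Dec; yes; no; ¬_)
open import Relation.Nullary.Decidable using (_×-dec_; ⌊_⌋; ¬?; _→-dec_)
open import Relation.Binary.PropositionalEquality using (_≡_; _≢_)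
open import Relation.Unary using (Pred)
import Relation.Binary.PropositionalEquality as Eq
open import Data.Vec.Properties using () renaming (≡-dec to vec-≡-dec)
open import Data.Bool.Properties using () renaming (_≟_ to _≟B_)

-- A loopless multigraph on vertex set Fin n: a list of edges (parallel
-- edges allowed, as repeated list entries); each edge has distinct ends.
record Multigraph (n : ℕ) : Set where
  field
    edges    : List (Fin n × Fin n)
    loopless : All (λ e → proj₁ e ≢ proj₂ e) edges
open Multigraph public

iH : ∀ {n} → Multigraph n → Subset n → ℕ
iH H X = length (filter (λ e → (proj₁ e ∈? X) ×-dec (proj₂ e ∈? X)) (edges H))

-- max{k|X| - ℓ, 0} computed in ℕ by truncated subtraction
bound : ℕ → ℕ → ℕ → ℕ
bound k ℓ m = k * m ∸ ℓ

Sparse : ℕ → ℕ → ∀ {n} → Multigraph n → Set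
Sparse k ℓ H = ∀ X → iH H X ≤ bound k ℓ ∣ X ∣

InducedTight : ℕ → ℕ → ∀ {n} → Multigraph n → Subset n → Set
InducedTight k ℓ H X =
  (∀ Y → Y ⊆ X → iH H Y ≤ bound k ℓ ∣ Y ∣) × (iH H X ≡ bound k ℓ ∣ X ∣)

IsBlock : ℕ → ℕ → ∀ {n} → Multigraph n → Subset n → Set
IsBlock = InducedTight

IsComponent : ℕ → ℕ → ∀ {n} → Multigraph n → Subset n → Set
IsComponent k ℓ H X = IsBlock k ℓ H X × (∀ Y → IsBlock k ℓ H Y → X ⊆ Y → X ≡ Y)

private
  allSubset? : ∀ {n} {P : Pred (Subset n) Agda.Primitive.lzero} →
               (∀ X → Dec (P X)) → Dec (∀ X → P X)
  allSubset? {P = P} P? with anySubset? (λ X → ¬? (P? X))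
  ... | yes (X , ¬px) = no (λ all → ¬px (all X))
  ... | no ¬ex = yes (λ X → dec X (P? X) ¬ex)
    where
    dec : ∀ X → Dec (P X) → (¬ ∃ (λ Y → ¬ P Y)) → P X
    dec X (yes p) _ = p
    dec X (no ¬p) ne with ne (X , ¬p)
    ... | ()

isBlock? : ∀ k ℓ {n} (H : Multigraph n) X → Dec (IsBlock k ℓ H X)
isBlock? k ℓ H X =
  allSubset? (λ Y → (Y ⊆? X) →-dec (iH H Y ≤? bound k ℓ ∣ Y ∣))
  ×-dec (iH H X ≟ bound k ℓ ∣ X ∣)

isComponent? : ∀ k ℓ {n} (H : Multigraph n) X → Dec (IsComponent k ℓ H X)
isComponent? k ℓ H X =
  isBlock? k ℓ H X ×-dec
  allSubset? (λ Y → isBlock? k ℓ H Y →-dec ((X ⊆? Y) →-dec vec-≡-dec _≟B_ X Y))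

-- list of all subsets of Fin n (each exactly once)
allSubsets : ∀ n → List (Subset n)
allSubsets zero = [] ∷ []
allSubsets (suc n) =
  map (inside ∷_) (allSubsets n) ++ map (outside ∷_) (allSubsets n)

componentSizeSum : ℕ → ℕ → ∀ {n} → Multigraph n → ℕ
componentSizeSum k ℓ {n} H =
  sum (map (λ X → if ⌊ isComponent? k ℓ H X ⌋ then ∣ X ∣ else 0) (allSubsets n))

-- Since ℓ < 2k, two (k,ℓ)-blocks X, Y with |X ∩ Y| ≥ 2 have a block as their
-- union: i_H is supermodular and k|X ∩ Y| ≥ ℓ.  By maximality, the two ends of
-- an edge therefore lie in at most one common component, so the components
-- together span at most |F| ≤ kn edges.  A component C with |C| ≥ 2 is tight
-- with k|C| > ℓ, hence spans i_H(C) ≥ 1 edges and |C| ≤ k|C| = i_H(C) + ℓ ≤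
-- (ℓ+1) i_H(C).  The remaining components are singletons, at most n of them.
module Submission where

open import Defs
open import Data.Bool using (if_then_else_)
open import Data.Empty using (⊥-elim)
open import Data.Fin using (Fin)
open import Data.Fin.Subset using (Subset; _∈_; _∪_; _∩_; ∣_∣; ⊤; ⊥; inside; outside)
open import Data.Fin.Subset.Properties
  using (_∈?_; ∈⊤; Empty-unique; ∣⊤∣≡n; p⊆p∪q; q⊆p∪q; x∈p∩q⁺;
         x∈p⇒∣p-x∣<∣p∣; x∈p∧x≢y⇒x∈p-y)
open import Data.List using (List; []; _∷_; _++_; filter; length; map)
open import Data.List.Properties using (map-++; map-∘; filter-all)
open import Data.List.Relation.Unary.All as All using (All; []; _∷_)
open import Data.Nat using (ℕ; zero; suc; >-nonZero; _+_; _*_; _∸_; _≤_; _<_; z≤n; s≤s)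
open import Data.Nat.ListAction using (sum)
open import Data.Nat.ListAction.Properties using (sum-++)
open import Data.Nat.Properties
  using (_≟_; ≤-refl; ≤-reflexive; ≤-trans; ≤-antisym; ≤-<-trans; <-≤-trans; <⇒≤; <⇒≢;
         n≮0; n≢0⇒n>0; +-comm; +-suc; +-mono-≤; +-monoʳ-≤; +-cancelʳ-≤; *-comm; *-assoc;
         *-identityˡ; *-identityʳ; *-distribˡ-+; *-distribʳ-+; *-monoʳ-≤; m≤m+n; m≤n+m;
         m≤n*m; m∸n≤m; m∸n+n≡m; m≤n+m∸n; m≤n+o⇒m∸n≤o; m≤o∸n⇒m+n≤o; m<n⇒0<n∸m;
         +-commutativeSemigroup; module ≤-Reasoning)
open import Algebra.Properties.CommutativeSemigroup +-commutativeSemigroup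
  using (interchange)
open import Data.Product using (∃; _×_; _,_; proj₁; proj₂)
open import Data.Vec using (_∷_; [])
open import Function using (_∘_)
open import Level using (Level)
open import Relation.Nullary using (Dec; yes; no; does; ¬_)
open import Relation.Nullary.Decidable using (_×-dec_; ⌊_⌋)
open import Relation.Binary.PropositionalEquality
  using (_≡_; _≢_; refl; sym; trans; cong; cong₂; subst; module ≡-Reasoning)
open import Relation.Unary using (Pred; Decidable)

private
  variable
    a p q r s : Level
    A B : Set a

𝟙 : {P : Set p} → Dec P → ℕ
𝟙 d = if does d then 1 else 0

module _ {f g : A → ℕ} where

  sum-map-+ : ∀ xs → sum (map (λ x → f x + g x) xs) ≡ sum (map f xs) + sum (map g xs)
  sum-map-+ []       = refl
  sum-map-+ (x ∷ xs) = trans (cong (f x + g x +_) (sum-map-+ xs))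
                             (interchange (f x) (g x) _ _)

  sum-map-mono-≤ : (∀ x → f x ≤ g x) → ∀ xs → sum (map f xs) ≤ sum (map g xs)
  sum-map-mono-≤ f≤g []       = z≤n
  sum-map-mono-≤ f≤g (x ∷ xs) = +-mono-≤ (f≤g x) (sum-map-mono-≤ f≤g xs)

sum-map-* : ∀ c (f : A → ℕ) xs → sum (map (λ x → c * f x) xs) ≡ c * sum (map f xs)
sum-map-* c f []       = sym (*-comm c 0)
sum-map-* c f (x ∷ xs) = trans (cong (c * f x +_) (sum-map-* c f xs))
                               (sym (*-distribˡ-+ c (f x) _))

sum-map-≤-length : {f : A → ℕ} {xs : List A} → All (λ x → f x ≤ 1) xs →
                   sum (map f xs) ≤ length xs
sum-map-≤-length []           = z≤n
sum-map-≤-length (fx≤1 ∷ f≤1) = +-mono-≤ fx≤1 (sum-map-≤-length f≤1)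

sum-map-swap : ∀ (f : A → B → ℕ) xs ys →
  sum (map (λ x → sum (map (f x) ys)) xs) ≡ sum (map (λ y → sum (map (λ x → f x y) xs)) ys)
sum-map-swap f []       ys = sym (sum-map-* 0 (λ _ → 0) ys)  -- 0 * _ computes to 0
sum-map-swap f (x ∷ xs) ys =
  trans (cong (sum (map (f x) ys) +_) (sum-map-swap f xs ys)) (sym (sum-map-+ ys))

module _ {P : Pred A p} (P? : Decidable P) where

  length-filter≡sum-𝟙 : ∀ xs → length (filter P? xs) ≡ sum (map (𝟙 ∘ P?) xs)
  length-filter≡sum-𝟙 []       = refl
  length-filter≡sum-𝟙 (x ∷ xs) with P? x
  ... | yes _ = cong suc (length-filter≡sum-𝟙 xs)
  ... | no  _ = length-filter≡sum-𝟙 xs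

  sum-𝟙-positive⇒∃ : ∀ xs → 0 < sum (map (𝟙 ∘ P?) xs) → ∃ P
  sum-𝟙-positive⇒∃ (x ∷ xs) pos with P? x
  ... | yes px = x , px
  ... | no  _  = sum-𝟙-positive⇒∃ xs pos

  sum-𝟙-×-dec : {Q : Set q} (Q? : Dec Q) → Q → ∀ xs →
                sum (map (λ x → 𝟙 (Q? ×-dec P? x)) xs) ≡ sum (map (𝟙 ∘ P?) xs)
  sum-𝟙-×-dec (yes _) _ xs = refl
  sum-𝟙-×-dec (no ¬q) q xs = ⊥-elim (¬q q)

𝟙-supermodular : {P : Set p} {Q : Set q} {R : Set r} {S : Set s}
  (P? : Dec P) (Q? : Dec Q) (R? : Dec R) (S? : Dec S) →
  (P → R) → (Q → R) → (P → Q → S) → 𝟙 P? + 𝟙 Q? ≤ 𝟙 R? + 𝟙 S?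
𝟙-supermodular (yes p) (yes q) (yes _) (yes _) _   _   _   = ≤-refl
𝟙-supermodular (yes p) (yes q) _       (no ¬s) _   _   p∧q = ⊥-elim (¬s (p∧q p q))
𝟙-supermodular (yes p) _       (no ¬r) _       p⇒r _   _   = ⊥-elim (¬r (p⇒r p))
𝟙-supermodular _       (yes q) (no ¬r) _       _   q⇒r _   = ⊥-elim (¬r (q⇒r q))
𝟙-supermodular (yes _) (no _)  (yes _) _       _   _   _   = s≤s z≤n
𝟙-supermodular (no _)  (yes _) (yes _) _       _   _   _   = s≤s z≤n
𝟙-supermodular (no _)  (no _)  _       _       _   _   _   = z≤n

length-filter-supermodular :
  {P : Pred A p} {Q : Pred A q} {R : Pred A r} {S : Pred A s}
  (P? : Decidable P) (Q? : Decidable Q) (R? : Decidable R) (S? : Decidable S) →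
  (∀ {x} → P x → R x) → (∀ {x} → Q x → R x) → (∀ {x} → P x → Q x → S x) → ∀ xs →
  length (filter P? xs) + length (filter Q? xs) ≤ length (filter R? xs) + length (filter S? xs)
length-filter-supermodular P? Q? R? S? P⇒R Q⇒R P∧Q⇒S xs = begin
  length (filter P? xs) + length (filter Q? xs)
    ≡⟨ cong₂ _+_ (length-filter≡sum-𝟙 P? xs) (length-filter≡sum-𝟙 Q? xs) ⟩
  sum (map (𝟙 ∘ P?) xs) + sum (map (𝟙 ∘ Q?) xs)
    ≡⟨ sum-map-+ xs ⟨
  sum (map (λ x → 𝟙 (P? x) + 𝟙 (Q? x)) xs)
    ≤⟨ sum-map-mono-≤ (λ x → 𝟙-supermodular (P? x) (Q? x) (R? x) (S? x) P⇒R Q⇒R P∧Q⇒S) xs ⟩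
  sum (map (λ x → 𝟙 (R? x) + 𝟙 (S? x)) xs)
    ≡⟨ sum-map-+ xs ⟩
  sum (map (𝟙 ∘ R?) xs) + sum (map (𝟙 ∘ S?) xs)
    ≡⟨ cong₂ _+_ (length-filter≡sum-𝟙 R? xs) (length-filter≡sum-𝟙 S? xs) ⟨
  length (filter R? xs) + length (filter S? xs) ∎
  where open ≤-Reasoning

+-≤1 : ∀ {m n} → m ≤ 1 → n ≤ 1 → (0 < m → ¬ 0 < n) → m + n ≤ 1
+-≤1 {zero}        _       n≤1 _    = n≤1
+-≤1 {suc zero} {zero}  m≤1 _ _    = m≤1
+-≤1 {suc zero} {suc n} _   _ both = ⊥-elim (both (s≤s z≤n) (s≤s z≤n))
+-≤1 {suc (suc m)} (s≤s ()) _ _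

sum-map-allSubsets-suc : ∀ {n} (f : Subset (suc n) → ℕ) →
  sum (map f (allSubsets (suc n))) ≡
  sum (map (f ∘ (inside ∷_)) (allSubsets n)) + sum (map (f ∘ (outside ∷_)) (allSubsets n))
sum-map-allSubsets-suc {n} f = begin
  sum (map f (map (inside ∷_) L ++ map (outside ∷_) L))
    ≡⟨ cong sum (map-++ f (map (inside ∷_) L) (map (outside ∷_) L)) ⟩
  sum (map f (map (inside ∷_) L) ++ map f (map (outside ∷_) L))
    ≡⟨ sum-++ (map f (map (inside ∷_) L)) (map f (map (outside ∷_) L)) ⟩
  sum (map f (map (inside ∷_) L)) + sum (map f (map (outside ∷_) L))
    ≡⟨ cong₂ (λ xs ys → sum xs + sum ys) (map-∘ L) (map-∘ L) ⟨
  sum (map (f ∘ (inside ∷_)) L) + sum (map (f ∘ (outside ∷_)) L) ∎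
  where
  open ≡-Reasoning
  L = allSubsets n

sum-𝟙-allSubsets-≤1 : ∀ n {P : Pred (Subset n) p} (P? : Decidable P) →
  (∀ {X Y} → P X → P Y → X ≡ Y) → sum (map (𝟙 ∘ P?) (allSubsets n)) ≤ 1
sum-𝟙-allSubsets-≤1 zero    P? unique = +-mono-≤ (𝟙≤1 (P? [])) z≤n
  where
  𝟙≤1 : {Q : Set p} (Q? : Dec Q) → 𝟙 Q? ≤ 1
  𝟙≤1 (yes _) = ≤-refl
  𝟙≤1 (no _)  = z≤n
sum-𝟙-allSubsets-≤1 (suc n) {P} P? unique
  rewrite sum-map-allSubsets-suc (𝟙 ∘ P?) =
  +-≤1 (sum-𝟙-allSubsets-≤1 n (P? ∘ (inside ∷_)) (λ PX PY → cong tail (unique PX PY)))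
       (sum-𝟙-allSubsets-≤1 n (P? ∘ (outside ∷_)) (λ PX PY → cong tail (unique PX PY)))
       λ inside-pos outside-pos →
         inside≢outside (sum-𝟙-positive⇒∃ (P? ∘ (inside ∷_)) (allSubsets n) inside-pos)
                        (sum-𝟙-positive⇒∃ (P? ∘ (outside ∷_)) (allSubsets n) outside-pos)
  where
  tail : Subset (suc n) → Subset n
  tail (_ ∷ X) = X
  inside≢outside : ∃ (P ∘ (inside ∷_)) → ¬ ∃ (P ∘ (outside ∷_))
  inside≢outside (X , PX) (Y , PY) with unique PX PY
  ... | ()

module _ {n : ℕ} where

  x∈p⇒0<∣p∣ : ∀ {x : Fin n} {p} → x ∈ p → 0 < ∣ p ∣
  x∈p⇒0<∣p∣ x∈p = ≤-<-trans z≤n (x∈p⇒∣p-x∣<∣p∣ x∈p)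

  x∈p∧y∈p∧x≢y⇒2≤∣p∣ : ∀ {x y : Fin n} {p} → x ∈ p → y ∈ p → x ≢ y → 2 ≤ ∣ p ∣
  x∈p∧y∈p∧x≢y⇒2≤∣p∣ x∈p y∈p x≢y =
    ≤-trans (s≤s (x∈p⇒0<∣p∣ (x∈p∧x≢y⇒x∈p-y y∈p (x≢y ∘ sym)))) (x∈p⇒∣p-x∣<∣p∣ x∈p)

  ∣p∣≡0⇒p≡⊥ : ∀ {p : Subset n} → ∣ p ∣ ≡ 0 → p ≡ ⊥
  ∣p∣≡0⇒p≡⊥ ∣p∣≡0 = Empty-unique λ (x , x∈p) → <⇒≢ (x∈p⇒0<∣p∣ x∈p) (sym ∣p∣≡0)

∣p∪q∣+∣p∩q∣≡∣p∣+∣q∣ : ∀ {n} (p q : Subset n) → ∣ p ∪ q ∣ + ∣ p ∩ q ∣ ≡ ∣ p ∣ + ∣ q ∣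
∣p∪q∣+∣p∩q∣≡∣p∣+∣q∣ []            []            = refl
∣p∪q∣+∣p∩q∣≡∣p∣+∣q∣ (outside ∷ p) (outside ∷ q) = ∣p∪q∣+∣p∩q∣≡∣p∣+∣q∣ p q
∣p∪q∣+∣p∩q∣≡∣p∣+∣q∣ (inside ∷ p)  (outside ∷ q) = cong suc (∣p∪q∣+∣p∩q∣≡∣p∣+∣q∣ p q)
∣p∪q∣+∣p∩q∣≡∣p∣+∣q∣ (outside ∷ p) (inside ∷ q)  =
  trans (cong suc (∣p∪q∣+∣p∩q∣≡∣p∣+∣q∣ p q)) (sym (+-suc ∣ p ∣ ∣ q ∣))
∣p∪q∣+∣p∩q∣≡∣p∣+∣q∣ (inside ∷ p)  (inside ∷ q)  = cong suc (begin
  ∣ p ∪ q ∣ + suc ∣ p ∩ q ∣ ≡⟨ +-suc ∣ p ∪ q ∣ ∣ p ∩ q ∣ ⟩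
  suc (∣ p ∪ q ∣ + ∣ p ∩ q ∣) ≡⟨ cong suc (∣p∪q∣+∣p∩q∣≡∣p∣+∣q∣ p q) ⟩
  suc (∣ p ∣ + ∣ q ∣) ≡⟨ +-suc ∣ p ∣ ∣ q ∣ ⟨
  ∣ p ∣ + suc ∣ q ∣ ∎)
  where open ≡-Reasoning

sum-𝟙-singletons-≤ : ∀ n → sum (map (λ X → 𝟙 (∣ X ∣ ≟ 1)) (allSubsets n)) ≤ n
sum-𝟙-singletons-≤ zero    = z≤n
sum-𝟙-singletons-≤ (suc n) = begin
  sum (map (λ X → 𝟙 (∣ X ∣ ≟ 1)) (allSubsets (suc n)))
    -- ∣ inside ∷ X ∣ ≟ 1 computes to ∣ X ∣ ≟ 0
    ≡⟨ sum-map-allSubsets-suc {n} (λ X → 𝟙 (∣ X ∣ ≟ 1)) ⟩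
  sum (map (λ X → 𝟙 (∣ X ∣ ≟ 0)) L) + sum (map (λ X → 𝟙 (∣ X ∣ ≟ 1)) L)
    ≤⟨ +-mono-≤ (sum-𝟙-allSubsets-≤1 n (λ X → ∣ X ∣ ≟ 0) ∣p∣≡0-unique) (sum-𝟙-singletons-≤ n) ⟩
  1 + n ∎
  where
  open ≤-Reasoning
  L = allSubsets n
  ∣p∣≡0-unique : ∀ {p q : Subset n} → ∣ p ∣ ≡ 0 → ∣ q ∣ ≡ 0 → p ≡ q
  ∣p∣≡0-unique ∣p∣≡0 ∣q∣≡0 = trans (∣p∣≡0⇒p≡⊥ ∣p∣≡0) (sym (∣p∣≡0⇒p≡⊥ ∣q∣≡0))

module _ {k ℓ : ℕ} (ℓ<2k : ℓ < 2 * k) where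

  ℓ<k*m : ∀ {m} → 2 ≤ m → ℓ < k * m
  ℓ<k*m {m} 2≤m = <-≤-trans ℓ<2k (subst (_≤ k * m) (*-comm k 2) (*-monoʳ-≤ k 2≤m))

  tight-size-≤ : ∀ {m i} → i ≡ k * m ∸ ℓ → m ≤ suc ℓ * i + 𝟙 (m ≟ 1)
  tight-size-≤ {zero}        _ = z≤n
  tight-size-≤ {suc zero}    _ = m≤n+m 1 _
  tight-size-≤ {m@(suc (suc _))} {i} i≡km∸ℓ = ≤-trans m≤[1+ℓ]i (m≤m+n _ _)
    where
    open ≤-Reasoning
    ℓ<km : ℓ < k * m
    ℓ<km = ℓ<k*m (s≤s (s≤s z≤n))
    0<k : 0 < k
    0<k = n≢0⇒n>0 λ k≡0 → n≮0 (subst (λ k → ℓ < 2 * k) k≡0 ℓ<2k)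
    m≤[1+ℓ]i : m ≤ suc ℓ * i
    m≤[1+ℓ]i = begin
      m            ≤⟨ m≤n*m m k {{>-nonZero 0<k}} ⟩
      k * m        ≡⟨ trans (cong (_+ ℓ) i≡km∸ℓ) (m∸n+n≡m (<⇒≤ ℓ<km)) ⟨
      i + ℓ        ≤⟨ +-monoʳ-≤ i (subst (_≤ ℓ * i) (*-identityʳ ℓ) (*-monoʳ-≤ ℓ 0<i)) ⟩
      i + ℓ * i    ∎
      where
      0<i : 0 < i
      0<i = subst (0 <_) (sym i≡km∸ℓ) (m<n⇒0<n∸m ℓ<km)

endsIn? : ∀ {n} (X : Subset n) (e : Fin n × Fin n) → Dec (proj₁ e ∈ X × proj₂ e ∈ X)
endsIn? X e = (proj₁ e ∈? X) ×-dec (proj₂ e ∈? X)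

module _ {n} (H : Multigraph n) where

  iH-supermodular : ∀ X Y → iH H X + iH H Y ≤ iH H (X ∪ Y) + iH H (X ∩ Y)
  iH-supermodular X Y =
    length-filter-supermodular (endsIn? X) (endsIn? Y) (endsIn? (X ∪ Y)) (endsIn? (X ∩ Y))
      (λ (u∈X , v∈X) → p⊆p∪q Y u∈X , p⊆p∪q Y v∈X)
      (λ (u∈Y , v∈Y) → q⊆p∪q X Y u∈Y , q⊆p∪q X Y v∈Y)
      (λ (u∈X , v∈X) (u∈Y , v∈Y) → x∈p∩q⁺ (u∈X , u∈Y) , x∈p∩q⁺ (v∈X , v∈Y))
      (edges H)

  iH-⊤ : iH H ⊤ ≡ length (edges H)
  iH-⊤ = cong length (filter-all (endsIn? ⊤) (All.universal (λ _ → ∈⊤ , ∈⊤) (edges H)))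

module _ {k ℓ : ℕ} (ℓ<2k : ℓ < 2 * k) {n} {H : Multigraph n} (sparse : Sparse k ℓ H) where

  tight⇒block : ∀ {X} → iH H X ≡ bound k ℓ ∣ X ∣ → IsBlock k ℓ H X
  tight⇒block tight = (λ Y _ → sparse Y) , tight

  block-∪ : ∀ {X Y} → IsBlock k ℓ H X → IsBlock k ℓ H Y → 2 ≤ ∣ X ∩ Y ∣ →
            IsBlock k ℓ H (X ∪ Y)
  block-∪ {X} {Y} (_ , tightX) (_ , tightY) 2≤∣X∩Y∣ =
    tight⇒block (≤-antisym (sparse (X ∪ Y)) (m≤n+o⇒m∸n≤o (k * ∣ X ∪ Y ∣) ℓ kU≤ℓ+iU))
    where
    open ≤-Reasoning
    iX = iH H X
    iY = iH H Y
    iU = iH H (X ∪ Y)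
    iI = iH H (X ∩ Y)
    ℓ+iI≤kI : ℓ + iI ≤ k * ∣ X ∩ Y ∣
    ℓ+iI≤kI = subst (_≤ k * ∣ X ∩ Y ∣) (+-comm iI ℓ)
      (m≤o∸n⇒m+n≤o iI (<⇒≤ (ℓ<k*m {k} ℓ<2k 2≤∣X∩Y∣)) (sparse (X ∩ Y)))
    kU≤ℓ+iU : k * ∣ X ∪ Y ∣ ≤ ℓ + iU
    kU≤ℓ+iU = +-cancelʳ-≤ (k * ∣ X ∩ Y ∣) (k * ∣ X ∪ Y ∣) (ℓ + iU) (begin
      k * ∣ X ∪ Y ∣ + k * ∣ X ∩ Y ∣
        ≡⟨ *-distribˡ-+ k ∣ X ∪ Y ∣ ∣ X ∩ Y ∣ ⟨
      k * (∣ X ∪ Y ∣ + ∣ X ∩ Y ∣)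
        ≡⟨ cong (k *_) (∣p∪q∣+∣p∩q∣≡∣p∣+∣q∣ X Y) ⟩
      k * (∣ X ∣ + ∣ Y ∣)
        ≡⟨ *-distribˡ-+ k ∣ X ∣ ∣ Y ∣ ⟩
      k * ∣ X ∣ + k * ∣ Y ∣
        ≤⟨ +-mono-≤ (subst (λ i → k * ∣ X ∣ ≤ ℓ + i) (sym tightX) (m≤n+m∸n _ ℓ))
                    (subst (λ i → k * ∣ Y ∣ ≤ ℓ + i) (sym tightY) (m≤n+m∸n _ ℓ)) ⟩
      (ℓ + iX) + (ℓ + iY)
        ≡⟨ interchange ℓ iX ℓ iY ⟩
      (ℓ + ℓ) + (iX + iY)
        ≤⟨ +-monoʳ-≤ (ℓ + ℓ) (iH-supermodular H X Y) ⟩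
      (ℓ + ℓ) + (iU + iI)
        ≡⟨ interchange ℓ ℓ iU iI ⟩
      (ℓ + iU) + (ℓ + iI)
        ≤⟨ +-monoʳ-≤ (ℓ + iU) ℓ+iI≤kI ⟩
      (ℓ + iU) + k * ∣ X ∩ Y ∣ ∎)

  component-unique : ∀ {e : Fin n × Fin n} → proj₁ e ≢ proj₂ e → ∀ {X Y} →
    IsComponent k ℓ H X × (proj₁ e ∈ X × proj₂ e ∈ X) →
    IsComponent k ℓ H Y × (proj₁ e ∈ Y × proj₂ e ∈ Y) → X ≡ Y
  component-unique u≢v {X} {Y} ((blockX , maxX) , u∈X , v∈X) ((blockY , maxY) , u∈Y , v∈Y) =
    trans (maxX (X ∪ Y) block (p⊆p∪q Y)) (sym (maxY (X ∪ Y) block (q⊆p∪q X Y)))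
    where
    block : IsBlock k ℓ H (X ∪ Y)
    block = block-∪ blockX blockY
      (x∈p∧y∈p∧x≢y⇒2≤∣p∣ (x∈p∩q⁺ (u∈X , u∈Y)) (x∈p∩q⁺ (v∈X , v∈Y)) u≢v)

  componentSpanning? : (e : Fin n × Fin n) (C : Subset n) →
                       Dec (IsComponent k ℓ H C × (proj₁ e ∈ C × proj₂ e ∈ C))
  componentSpanning? e C = isComponent? k ℓ H C ×-dec endsIn? C e

  componentEdges : Subset n → ℕ
  componentEdges C = sum (map (λ e → 𝟙 (componentSpanning? e C)) (edges H))

  sum-componentEdges-≤ : sum (map componentEdges (allSubsets n)) ≤ length (edges H)
  sum-componentEdges-≤ = ≤-trans
    (≤-reflexive (sum-map-swap (λ C e → 𝟙 (componentSpanning? e C)) (allSubsets n) (edges H)))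
    (sum-map-≤-length (All.map (λ {e} u≢v →
      sum-𝟙-allSubsets-≤1 n (componentSpanning? e) (component-unique u≢v)) (loopless H)))

  component-size-≤ : ∀ C → (if ⌊ isComponent? k ℓ H C ⌋ then ∣ C ∣ else 0) ≤
                           suc ℓ * componentEdges C + 𝟙 (∣ C ∣ ≟ 1)
  component-size-≤ C with isComponent? k ℓ H C
  ... | no  _ = z≤n
  ... | yes component@((_ , tight) , _) =
    subst (λ i → ∣ C ∣ ≤ suc ℓ * i + 𝟙 (∣ C ∣ ≟ 1)) iH≡componentEdges (tight-size-≤ {k} ℓ<2k tight)
    where
    iH≡componentEdges : iH H C ≡ componentEdges C
    iH≡componentEdges = trans (length-filter≡sum-𝟙 (endsIn? C) (edges H))
      (sym (sum-𝟙-×-dec (endsIn? C) (isComponent? k ℓ H C) component (edges H)))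

  edges-≤ : length (edges H) ≤ k * n
  edges-≤ = begin
    length (edges H) ≡⟨ iH-⊤ H ⟨
    iH H ⊤           ≤⟨ sparse ⊤ ⟩
    k * ∣ ⊤ {n} ∣ ∸ ℓ ≤⟨ m∸n≤m _ ℓ ⟩
    k * ∣ ⊤ {n} ∣     ≡⟨ cong (k *_) (∣⊤∣≡n n) ⟩
    k * n            ∎
    where open ≤-Reasoning

  componentSizeSum-≤ : componentSizeSum k ℓ H ≤ (suc ℓ * k + 1) * n
  componentSizeSum-≤ = begin
    componentSizeSum k ℓ H
      ≤⟨ sum-map-mono-≤ component-size-≤ L ⟩
    sum (map (λ C → suc ℓ * componentEdges C + 𝟙 (∣ C ∣ ≟ 1)) L)
      ≡⟨ sum-map-+ L ⟩
    sum (map (λ C → suc ℓ * componentEdges C) L) + sum (map (λ C → 𝟙 (∣ C ∣ ≟ 1)) L)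
      ≡⟨ cong (_+ _) (sum-map-* (suc ℓ) componentEdges L) ⟩
    suc ℓ * sum (map componentEdges L) + sum (map (λ C → 𝟙 (∣ C ∣ ≟ 1)) L)
      ≤⟨ +-mono-≤ (*-monoʳ-≤ (suc ℓ) (≤-trans sum-componentEdges-≤ edges-≤))
                  (sum-𝟙-singletons-≤ n) ⟩
    suc ℓ * (k * n) + n
      ≡⟨ cong₂ _+_ (*-assoc (suc ℓ) k n) (*-identityˡ n) ⟨
    suc ℓ * k * n + 1 * n
      ≡⟨ *-distribʳ-+ n (suc ℓ * k) 1 ⟨
    (suc ℓ * k + 1) * n ∎
    where
    open ≤-Reasoning
    L = allSubsets n

corollary3 : (k ℓ : ℕ) → ℓ < 2 * k →
    ∃ λ (c : ℕ) → ∀ (n : ℕ) (H : Multigraph n) → Sparse k ℓ H →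
      componentSizeSum k ℓ H ≤ c * n
corollary3 k ℓ ℓ<2k = suc ℓ * k + 1 , λ n H sparse → componentSizeSum-≤ {k} ℓ<2k {H = H} sparse
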